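{- Let $N\geq 1$, $q$ a prime power, $k\in\{0,1,\dots,N-1\}$, and let $\mathcal{B}$ be a strong $k$-blocking set of $\mathrm{PG}(N,q)$. Let $\Sigma$ be a hyperplane and $P$ a point with $P\notin\mathcal{B}\cup\Sigma$. Then $\mathcal{B}':=\{\langle P,S\rangle\cap\Sigma : S\in\mathcal{B}\}$ is a strong $k$-blocking set of $\Sigma\cong\mathrm{PG}(N-1,q)$.
   Context: $\mathrm{PG}(N,q)$ denotes the Desarguesian projective space of dimension $N$ over $\mathbb{F}_q$. For $k\in\{0,\dots,N-1\}$, a strong $k$-blocking set of $\mathrm{PG}(N,q)$ is a point set that meets every $(N-k)$-dimensional subspace $\kappa$ in a set of points spanning $\kappa$ (and analogously in $\mathrm{PG}(N-1,q)$ with $(N-1-k)$-subspaces). $\langle\cdot\rangle$ denotes span. -}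

module Defs where

open import Level using (Level; _⊔_)
import Level
open import Data.Nat using (ℕ; zero; suc; _^_; _∸_)
open import Data.Nat.Primality using (Prime)
open import Data.Fin using (Fin) renaming (zero to fzero; suc to fsuc)
open import Data.Product using (Σ; ∃; _×_; _,_)
open import Relation.Nullary using (¬_)
open import Relation.Unary using (Pred)
open import Relation.Binary.PropositionalEquality using (_≡_)
import Relation.Binary.PropositionalEquality as ≡
open import Algebra.Bundles using (CommutativeRing)
open import Function.Bundles using (Inverse)

record Field (c ℓ : Level) : Set (Level.suc (c ⊔ ℓ)) where
  field
    commutativeRing : CommutativeRing c ℓ
  open CommutativeRing commutativeRing public
  field
    1≉0     : ¬ (1# ≈ 0#)
    inverse : ∀ x → ¬ (x ≈ 0#) → ∃ λ y → x * y ≈ 1#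

HasOrder : ∀ {c ℓ} → Field c ℓ → ℕ → Set (c ⊔ ℓ)
HasOrder F q = Inverse (Field.setoid F) (≡.setoid (Fin q))

IsPrimePower : ℕ → Set
IsPrimePower q = ∃ λ p → ∃ λ e → Prime p × q ≡ p ^ suc e

module _ {c ℓ} (F : Field c ℓ) where
  open Field F

  Vect : ℕ → Set c
  Vect n = Fin n → Carrier

  ∑ : ∀ {m} → (Fin m → Carrier) → Carrier
  ∑ {zero}  f = 0#
  ∑ {suc m} f = f fzero + ∑ (λ i → f (fsuc i))

  _≈ᵥ_ : ∀ {n} → Vect n → Vect n → Set ℓ
  u ≈ᵥ v = ∀ j → u j ≈ v j

  0ᵥ : ∀ {n} → Vect n
  0ᵥ _ = 0#

  NonZero : ∀ {n} → Vect n → Set ℓ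
  NonZero v = ¬ (v ≈ᵥ 0ᵥ)

  _·ᵥ_ : ∀ {n} → Carrier → Vect n → Vect n
  (a ·ᵥ v) j = a * v j

  linComb : ∀ {m n} → (Fin m → Carrier) → (Fin m → Vect n) → Vect n
  linComb cs ws j = ∑ (λ i → cs i * ws i j)

  InSpan : ∀ {m n} → (Fin m → Vect n) → Vect n → Set (c ⊔ ℓ)
  InSpan ws v = ∃ λ cs → v ≈ᵥ linComb cs ws

  LinIndep : ∀ {m n} → (Fin m → Vect n) → Set (c ⊔ ℓ)
  LinIndep ws = ∀ cs → linComb cs ws ≈ᵥ 0ᵥ → ∀ i → cs i ≈ 0#

  -- A point set of PG(n-1,F) is given by a predicate on F^n; the point
  -- ⟨x⟩ belongs to B iff x ≠ 0 and some nonzero multiple of x satisfies B.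
  _∈ₚ_ : ∀ {n ℓ'} → Vect n → Pred (Vect n) ℓ' → Set (c ⊔ ℓ ⊔ ℓ')
  x ∈ₚ B = NonZero x × ∃ λ a → ¬ (a ≈ 0#) × B (a ·ᵥ x)

  SpansMeet : ∀ {m n ℓ'} → Pred (Vect n) ℓ' → (Fin m → Vect n) → Set (c ⊔ ℓ ⊔ ℓ')
  SpansMeet B bs =
    ∀ v → InSpan bs v →
      ∃ λ r → Σ (Fin r → Vect _) λ xs →
        (∀ i → (xs i ∈ₚ B) × InSpan bs (xs i)) × InSpan xs v

  -- Strong k-blocking set of PG(N,F) (vectors in F^(N+1)): meets every
  -- (N-k)-dimensional projective subspace κ (spanned by N-k+1 independent
  -- vectors) in a set of points spanning κ.
  StrongBlockingPG : ∀ {ℓ'} (N k : ℕ) → Pred (Vect (suc N)) ℓ' → Set (c ⊔ ℓ ⊔ ℓ')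
  StrongBlockingPG N k B =
    (bs : Fin (suc (N ∸ k)) → Vect (suc N)) → LinIndep bs → SpansMeet B bs

  -- Strong k-blocking set of the (m)-dimensional projective subspace
  -- Π = ⟨ws⟩ ≅ PG(m,F) (ws : m+1 independent vectors): a set of points of Π
  -- meeting every (m-k)-dimensional subspace κ of Π in points spanning κ.
  StrongBlockingSub : ∀ {ℓ' n} (m k : ℕ) → (Fin (suc m) → Vect n) →
                      Pred (Vect n) ℓ' → Set (c ⊔ ℓ ⊔ ℓ')
  StrongBlockingSub m k ws B =
    (∀ x → x ∈ₚ B → InSpan ws x) ×
    ((bs : Fin (suc (m ∸ k)) → Vect _) → LinIndep bs →
       (∀ i → InSpan ws (bs i)) → SpansMeet B bs)

  -- B' = { ⟨P,S⟩ ∩ Σ : S ∈ B }: a vector y represents a point of B' iff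
  -- y ≠ 0, y ∈ Σ = ⟨σ⟩ and y ∈ ⟨P,S⟩ for some point S of B.
  projectFrom : ∀ {ℓ' m n} → Vect n → (Fin m → Vect n) → Pred (Vect n) ℓ' →
                Pred (Vect n) (c ⊔ ℓ ⊔ ℓ')
  projectFrom P σ B y =
    NonZero y × InSpan σ y ×
    ∃ λ S → (S ∈ₚ B) × InSpan {2} (λ { fzero → P ; (fsuc _) → S }) y

-- Let κ' = ⟨bs⟩ be a subspace of Σ of the dimension in question. Since P ∉ Σ, κ = ⟨P, bs⟩
-- is a subspace of PG(N,q) of dimension one more, so the points S of B in κ span κ. Write
-- each such S as αP + w with w ∈ κ'; a nonzero w is the point ⟨P,S⟩ ∩ Σ of B'. A vector of
-- κ' combined from the S is the same combination of the w plus a multiple of P, and that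
-- multiple vanishes because P ∉ κ'; dropping the zero w leaves points of B' spanning κ'.

module Submission where

open import Defs
open import Level using (Level)
open import Data.Nat using (ℕ; zero; suc; _<_; _∸_; s≤s)
open import Data.Nat.Properties using (+-∸-assoc)
open import Data.Fin using (Fin) renaming (zero to fzero; suc to fsuc)
open import Data.Fin.Properties using (all?) renaming (_≟_ to _≟ᶠ_)
open import Data.Vec.Functional using (_∷_; [])
open import Data.Product using (Σ; ∃; _×_; _,_; proj₁; proj₂)
open import Function.Properties.Inverse using (Inverse⇒Injection)
open import Relation.Binary.Definitions using (Decidable)
open import Relation.Binary.PropositionalEquality using (subst)
open import Relation.Nullary using (¬_; yes; no; contradiction)
open import Relation.Nullary.Decidable using (via-injection)
open import Relation.Unary using (Pred)
import Algebra.Properties.CommutativeSemigroup as CommutativeSemigroupProperties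
import Algebra.Properties.Group as GroupProperties
import Algebra.Properties.Ring as RingProperties
import Relation.Binary.Reasoning.Setoid as SetoidReasoning

≈-decidable : ∀ {c ℓ} (F : Field c ℓ) {q} → HasOrder F q → Decidable (Field._≈_ F)
≈-decidable F order = via-injection (Inverse⇒Injection order) _≟ᶠ_

module LinearAlgebra {c ℓ} (F : Field c ℓ) where
  open Field F
  open CommutativeSemigroupProperties +-commutativeSemigroup using (interchange)
  open GroupProperties +-group using (\\-leftDividesʳ; //-rightDividesʳ)
  open RingProperties ring using (-1*x≈-x; -‿distribˡ-*)
  open SetoidReasoning setoid

  ∑-cong : ∀ {m} {f g : Fin m → Carrier} → (∀ i → f i ≈ g i) → ∑ F f ≈ ∑ F g
  ∑-cong {zero}  _   = refl
  ∑-cong {suc m} f≈g = +-cong (f≈g fzero) (∑-cong (λ i → f≈g (fsuc i)))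

  ∑-zero : ∀ {m} {f : Fin m → Carrier} → (∀ i → f i ≈ 0#) → ∑ F f ≈ 0#
  ∑-zero {zero}  _   = refl
  ∑-zero {suc m} f≈0 = trans (+-cong (f≈0 fzero) (∑-zero (λ i → f≈0 (fsuc i)))) (+-identityˡ 0#)

  ∑-+ : ∀ {m} (f g : Fin m → Carrier) → ∑ F (λ i → f i + g i) ≈ ∑ F f + ∑ F g
  ∑-+ {zero}  _ _ = sym (+-identityˡ 0#)
  ∑-+ {suc m} f g = trans (+-congˡ (∑-+ (λ i → f (fsuc i)) (λ i → g (fsuc i))))
                          (interchange (f fzero) (g fzero) _ _)

  ∑-*ˡ : ∀ {m} a (f : Fin m → Carrier) → a * ∑ F f ≈ ∑ F (λ i → a * f i)
  ∑-*ˡ {zero}  a _ = zeroʳ a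
  ∑-*ˡ {suc m} a f = trans (distribˡ a _ _) (+-congˡ (∑-*ˡ a (λ i → f (fsuc i))))

  ∑-*ʳ : ∀ {m} a (f : Fin m → Carrier) → ∑ F f * a ≈ ∑ F (λ i → f i * a)
  ∑-*ʳ a f = trans (*-comm _ a) (trans (∑-*ˡ a f) (∑-cong (λ i → *-comm a (f i))))

  ∑-swap : ∀ {m p} (f : Fin m → Fin p → Carrier) →
           ∑ F (λ i → ∑ F (f i)) ≈ ∑ F (λ l → ∑ F (λ i → f i l))
  ∑-swap {zero} {p} _ = sym (∑-zero {p} (λ _ → refl))
  ∑-swap {suc m} f = trans (+-congˡ (∑-swap (λ i → f (fsuc i))))
                           (sym (∑-+ (f fzero) (λ l → ∑ F (λ i → f (fsuc i) l))))

  module _ {m n} {ws : Fin m → Vect F n} where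

    InSpan-resp : ∀ {u v} → (∀ j → u j ≈ v j) → InSpan F ws u → InSpan F ws v
    InSpan-resp u≈v (cs , u≈) = cs , λ j → trans (sym (u≈v j)) (u≈ j)

    InSpan-0ᵥ : InSpan F ws (0ᵥ F)
    InSpan-0ᵥ = (λ _ → 0#) , λ _ → sym (∑-zero {m} (λ i → zeroˡ (ws i _)))

    InSpan-·ᵥ : ∀ a {v} → InSpan F ws v → InSpan F ws (_·ᵥ_ F a v)
    InSpan-·ᵥ a (cs , v≈) = (λ i → a * cs i) , λ j →
      trans (*-congˡ (v≈ j))
            (trans (∑-*ˡ a (λ i → cs i * ws i j)) (∑-cong {m} (λ i → sym (*-assoc a (cs i) (ws i j)))))

    InSpan-+ : ∀ {u v} → InSpan F ws u → InSpan F ws v → InSpan F ws (λ j → u j + v j)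
    InSpan-+ (cs , u≈) (ds , v≈) = (λ i → cs i + ds i) , λ j →
      trans (+-cong (u≈ j) (v≈ j))
            (trans (sym (∑-+ (λ i → cs i * ws i j) (λ i → ds i * ws i j)))
                   (∑-cong {m} (λ i → sym (distribʳ (ws i j) (cs i) (ds i)))))

    InSpan-neg : ∀ {v} → InSpan F ws v → InSpan F ws (λ j → - v j)
    InSpan-neg v∈ws = InSpan-resp (λ j → -1*x≈-x _) (InSpan-·ᵥ (- 1#) v∈ws)

    InSpan-·ᵥ⁻¹ : ∀ {a v} → ¬ (a ≈ 0#) → InSpan F ws (_·ᵥ_ F a v) → InSpan F ws v
    InSpan-·ᵥ⁻¹ {a} {v} a≉0 av∈ws with inverse a a≉0
    ... | b , ab≈1 = InSpan-resp b[av]≈v (InSpan-·ᵥ b av∈ws)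
      where
        b[av]≈v : ∀ j → b * (a * v j) ≈ v j
        b[av]≈v j = begin
          b * (a * v j)  ≈⟨ *-assoc b a (v j) ⟨
          b * a * v j    ≈⟨ *-congʳ (trans (*-comm b a) ab≈1) ⟩
          1# * v j       ≈⟨ *-identityˡ (v j) ⟩
          v j            ∎

  InSpan-trans : ∀ {m p n} {ws : Fin m → Vect F n} {us : Fin p → Vect F n} {v} →
                 InSpan F ws v → (∀ i → InSpan F us (ws i)) → InSpan F us v
  InSpan-trans {m} {p} {ws = ws} {us} {v} (cs , v≈) ws⊆us = ds , λ j → begin
    v j                                                   ≈⟨ v≈ j ⟩
    ∑ F (λ i → cs i * ws i j)                             ≈⟨ ∑-cong (λ i → *-congˡ (proj₂ (ws⊆us i) j)) ⟩
    ∑ F (λ i → cs i * ∑ F (λ l → e i l * us l j))         ≈⟨ ∑-cong {m} (λ i → ∑-*ˡ (cs i) (λ l → e i l * us l j)) ⟩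
    ∑ F (λ i → ∑ F (λ l → cs i * (e i l * us l j)))       ≈⟨ ∑-cong {m} (λ i → ∑-cong {p} (λ l → *-assoc (cs i) (e i l) (us l j))) ⟨
    ∑ F (λ i → ∑ F (λ l → cs i * e i l * us l j))         ≈⟨ ∑-swap (λ i l → cs i * e i l * us l j) ⟩
    ∑ F (λ l → ∑ F (λ i → cs i * e i l * us l j))         ≈⟨ ∑-cong (λ l → ∑-*ʳ (us l j) (λ i → cs i * e i l)) ⟨
    ∑ F (λ l → ds l * us l j)                             ∎
    where
      e : Fin m → Fin p → Carrier
      e i = proj₁ (ws⊆us i)
      ds : Fin p → Carrier
      ds l = ∑ F (λ i → cs i * e i l)

  linComb-split : ∀ {r n} (P : Vect F n) (α : Fin r → Carrier) (ws ys : Fin r → Vect F n) →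
    (∀ i j → ys i j ≈ α i * P j + ws i j) →
    ∀ cs j → linComb F cs ys j ≈ ∑ F (λ i → cs i * α i) * P j + linComb F cs ws j
  linComb-split P α ws ys ys≈ cs j = begin
    ∑ F (λ i → cs i * ys i j)                                     ≈⟨ ∑-cong (λ i → *-congˡ (ys≈ i j)) ⟩
    ∑ F (λ i → cs i * (α i * P j + ws i j))                       ≈⟨ ∑-cong (λ i → distribˡ (cs i) _ _) ⟩
    ∑ F (λ i → cs i * (α i * P j) + cs i * ws i j)                ≈⟨ ∑-+ (λ i → cs i * (α i * P j)) (λ i → cs i * ws i j) ⟩
    ∑ F (λ i → cs i * (α i * P j)) + linComb F cs ws j            ≈⟨ +-congʳ (∑-cong (λ i → *-assoc (cs i) _ _)) ⟨
    ∑ F (λ i → cs i * α i * P j) + linComb F cs ws j              ≈⟨ +-congʳ (∑-*ʳ (P j) (λ i → cs i * α i)) ⟨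
    ∑ F (λ i → cs i * α i) * P j + linComb F cs ws j              ∎

  ∈ₚ-intro : ∀ {ℓ' n} {B : Pred (Vect F n) ℓ'} → (∀ {x y} → (∀ j → x j ≈ y j) → B x → B y) →
             ∀ {x} → NonZero F x → B x → _∈ₚ_ F x B
  ∈ₚ-intro B-resp x≉0 x∈B = x≉0 , 1# , 1≉0 , B-resp (λ j → sym (*-identityˡ _)) x∈B

  module _ {ℓ' m n} {P : Vect F n} {σ : Fin m → Vect F n} {B : Pred (Vect F n) ℓ'} where

    projectFrom-resp : ∀ {x y} → (∀ j → x j ≈ y j) → projectFrom F P σ B x → projectFrom F P σ B y
    projectFrom-resp x≈y (x≉0 , x∈σ , S , S∈B , cs , x≈cs·PS) =
      (λ y≈0 → x≉0 (λ j → trans (x≈y j) (y≈0 j))) , InSpan-resp x≈y x∈σ ,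
      S , S∈B , cs , λ j → trans (sym (x≈y j)) (x≈cs·PS j)

    ∈ₚ-projectFrom⇒InSpan : ∀ x → _∈ₚ_ F x (projectFrom F P σ B) → InSpan F σ x
    ∈ₚ-projectFrom⇒InSpan x (_ , _ , a≉0 , _ , ax∈σ , _) = InSpan-·ᵥ⁻¹ a≉0 ax∈σ

    projectFrom-intro : ∀ {w S α} → NonZero F w → InSpan F σ w → _∈ₚ_ F S B →
                        (∀ j → S j ≈ α * P j + w j) → _∈ₚ_ F w (projectFrom F P σ B)
    projectFrom-intro {w} {S} {α} w≉0 w∈σ S∈B S≈αP+w =
      ∈ₚ-intro projectFrom-resp w≉0 (w≉0 , w∈σ , S , S∈B , (- α ∷ 1# ∷ []) , w≈S-αP)
      where
        w≈S-αP : ∀ j → w j ≈ - α * P j + (1# * S j + 0#)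
        w≈S-αP j = begin
          w j                               ≈⟨ \\-leftDividesʳ (α * P j) (w j) ⟨
          - (α * P j) + (α * P j + w j)     ≈⟨ +-cong (-‿distribˡ-* α (P j)) (sym (S≈αP+w j)) ⟩
          - α * P j + S j                   ≈⟨ +-congˡ (trans (+-identityʳ _) (*-identityˡ _)) ⟨
          - α * P j + (1# * S j + 0#)       ∎

  module _ (_≟_ : Decidable _≈_) where

    ∉span⇒coefficient≈0 : ∀ {m n} {ws : Fin m → Vect F n} {P v u : Vect F n} {β} →
      ¬ InSpan F ws P → InSpan F ws v → InSpan F ws u → (∀ j → v j ≈ β * P j + u j) → β ≈ 0#
    ∉span⇒coefficient≈0 {ws = ws} {P} {u = u} {β} P∉ws v∈ws u∈ws v≈βP+u with β ≟ 0#
    ... | yes β≈0 = β≈0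
    ... | no β≉0  = contradiction (InSpan-·ᵥ⁻¹ β≉0 βP∈ws) P∉ws
      where
        βP∈ws : InSpan F ws (_·ᵥ_ F β P)
        βP∈ws = InSpan-resp (λ j → trans (+-congʳ (v≈βP+u j)) (//-rightDividesʳ (u j) (β * P j)))
                            (InSpan-+ v∈ws (InSpan-neg u∈ws))

    LinIndep-∷ : ∀ {m n} {ws : Fin m → Vect F n} {P} → LinIndep F ws → ¬ InSpan F ws P → LinIndep F (P ∷ ws)
    LinIndep-∷ {ws = ws} {P} ws-indep P∉ws cs comb≈0 = λ
      { fzero    → head≈0
      ; (fsuc i) → ws-indep (λ i → cs (fsuc i)) tail≈0 i
      }
      where
        head≈0 : cs fzero ≈ 0#
        head≈0 = ∉span⇒coefficient≈0 P∉ws InSpan-0ᵥ ((λ i → cs (fsuc i)) , λ _ → refl) (λ j → sym (comb≈0 j))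
        tail≈0 : ∀ j → linComb F (λ i → cs (fsuc i)) ws j ≈ 0#
        tail≈0 j = begin
          linComb F (λ i → cs (fsuc i)) ws j                  ≈⟨ +-identityˡ _ ⟨
          0# + linComb F (λ i → cs (fsuc i)) ws j             ≈⟨ +-congʳ (trans (*-congʳ head≈0) (zeroˡ (P j))) ⟨
          cs fzero * P j + linComb F (λ i → cs (fsuc i)) ws j ≈⟨ comb≈0 j ⟩
          0#                                                  ∎

    linComb-nonZero-subfamily : ∀ {ℓq m n} (Q : Pred (Vect F n) ℓq) (ws : Fin m → Vect F n) →
      (∀ i → NonZero F (ws i) → Q (ws i)) → ∀ cs →
      ∃ λ r → Σ (Fin r → Vect F n) λ xs → (∀ i → Q (xs i)) × InSpan F xs (linComb F cs ws)
    linComb-nonZero-subfamily {m = zero}  _ _  _         _  = 0 , [] , (λ ()) , [] , λ _ → refl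
    linComb-nonZero-subfamily {m = suc m} Q ws nonZero⇒Q cs
      with linComb-nonZero-subfamily Q (λ i → ws (fsuc i)) (λ i → nonZero⇒Q (fsuc i)) (λ i → cs (fsuc i))
         | all? (λ j → ws fzero j ≟ 0#)
    ... | r , xs , Qxs , ds , rest≈ | yes w₀≈0 = r , xs , Qxs , ds , λ j →
          trans (+-congʳ (trans (*-congˡ (w₀≈0 j)) (zeroʳ _))) (trans (+-identityˡ _) (rest≈ j))
    ... | r , xs , Qxs , ds , rest≈ | no w₀≉0 =
          suc r , ws fzero ∷ xs , (λ { fzero → nonZero⇒Q fzero w₀≉0 ; (fsuc i) → Qxs i }) ,
          cs fzero ∷ ds , λ j → +-congˡ (rest≈ j)

    nonZero-subfamily-spans : ∀ {ℓq m n} (Q : Pred (Vect F n) ℓq) (ws : Fin m → Vect F n) →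
      (∀ i → NonZero F (ws i) → Q (ws i)) → ∀ {v} → InSpan F ws v →
      ∃ λ r → Σ (Fin r → Vect F n) λ xs → (∀ i → Q (xs i)) × InSpan F xs v
    nonZero-subfamily-spans Q ws nonZero⇒Q (cs , v≈) with linComb-nonZero-subfamily Q ws nonZero⇒Q cs
    ... | r , xs , Qxs , c·ws∈xs = r , xs , Qxs , InSpan-resp (λ j → sym (v≈ j)) c·ws∈xs

    projectFrom-spansMeet : ∀ {ℓ' m k n} {B : Pred (Vect F n) ℓ'} {σ : Fin m → Vect F n} {P : Vect F n}
      {bs : Fin k → Vect F n} → (∀ i → InSpan F σ (bs i)) → ¬ InSpan F bs P →
      SpansMeet F B (P ∷ bs) → SpansMeet F (projectFrom F P σ B) bs
    projectFrom-spansMeet {k = k} {n} {B} {σ} {P} {bs} bs⊆σ P∉bs meets v (cs , v≈)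
      with meets v ((0# ∷ cs) , λ j → trans (v≈ j) (sym (trans (+-congʳ (zeroˡ (P j))) (+-identityˡ _))))
    ... | s , ys , ys∈B∩κ , c , v≈c·ys =
      nonZero-subfamily-spans (λ x → _∈ₚ_ F x (projectFrom F P σ B) × InSpan F bs x) w w-projected (c , v≈c·w)
      where
        d : Fin s → Fin (suc k) → Carrier
        d i = proj₁ (proj₂ (ys∈B∩κ i))
        α : Fin s → Carrier
        α i = d i fzero
        w : Fin s → Vect F n
        w i = linComb F (λ l → d i (fsuc l)) bs
        ys≈αP+w : ∀ i j → ys i j ≈ α i * P j + w i j
        ys≈αP+w i = proj₂ (proj₂ (ys∈B∩κ i))
        w∈bs : ∀ i → InSpan F bs (w i)
        w∈bs i = _ , λ _ → refl
        v≈βP+c·w : ∀ j → v j ≈ ∑ F (λ i → c i * α i) * P j + linComb F c w j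
        v≈βP+c·w j = trans (v≈c·ys j) (linComb-split P α w ys ys≈αP+w c j)
        β≈0 : ∑ F (λ i → c i * α i) ≈ 0#
        β≈0 = ∉span⇒coefficient≈0 P∉bs (cs , v≈) (InSpan-trans (c , λ _ → refl) w∈bs) v≈βP+c·w
        v≈c·w : ∀ j → v j ≈ linComb F c w j
        v≈c·w j = begin
          v j                                                 ≈⟨ v≈βP+c·w j ⟩
          ∑ F (λ i → c i * α i) * P j + linComb F c w j       ≈⟨ +-congʳ (trans (*-congʳ β≈0) (zeroˡ (P j))) ⟩
          0# + linComb F c w j                                ≈⟨ +-identityˡ _ ⟩
          linComb F c w j                                     ∎
        w-projected : ∀ i → NonZero F (w i) → _∈ₚ_ F (w i) (projectFrom F P σ B) × InSpan F bs (w i)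
        w-projected i w≉0 =
          projectFrom-intro {P = P} {σ} {B} w≉0 (InSpan-trans (w∈bs i) bs⊆σ) (proj₁ (ys∈B∩κ i))
                            (ys≈αP+w i) ,
          w∈bs i

-- The order q is used only to decide equality in F.
mainTheorem12 : ∀ {c ℓ ℓ' : Level} (F : Field c ℓ) (q : ℕ) →
    IsPrimePower q → HasOrder F q →
    (n k : ℕ) → k < suc n →
    (B : Pred (Vect F (suc (suc n))) ℓ') → StrongBlockingPG F (suc n) k B →
    (σ : Fin (suc n) → Vect F (suc (suc n))) → LinIndep F σ →
    (P : Vect F (suc (suc n))) → NonZero F P →
    ¬ (_∈ₚ_ F P B) → ¬ (InSpan F σ P) →
    StrongBlockingSub F n k σ (projectFrom F P σ B)
mainTheorem12 F _ _ order n k (s≤s k≤n) B B-blocking σ _ P _ _ P∉σ =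
  ∈ₚ-projectFrom⇒InSpan {P = P} {σ} {B} , meets
  where
    open LinearAlgebra F
    _≟_ : Decidable (Field._≈_ F)
    _≟_ = ≈-decidable F order

    B-blocking′ : (bs : Fin (suc (suc (n ∸ k))) → Vect F (suc (suc n))) → LinIndep F bs → SpansMeet F B bs
    B-blocking′ = subst (λ d → (bs : Fin (suc d) → Vect F (suc (suc n))) → LinIndep F bs → SpansMeet F B bs)
                        (+-∸-assoc 1 k≤n) B-blocking

    meets : (bs : Fin (suc (n ∸ k)) → Vect F (suc (suc n))) → LinIndep F bs →
            (∀ i → InSpan F σ (bs i)) → SpansMeet F (projectFrom F P σ B) bs
    meets bs bs-indep bs⊆σ =
      projectFrom-spansMeet _≟_ {B = B} {σ} {P} bs⊆σ P∉bs
        (B-blocking′ (P ∷ bs) (LinIndep-∷ _≟_ {ws = bs} bs-indep P∉bs))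
      where
        P∉bs : ¬ InSpan F bs P
        P∉bs P∈bs = P∉σ (InSpan-trans {ws = bs} {σ} P∈bs bs⊆σ)
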